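{- Let $t,s$ be $\lambda$-terms with $t \to_{\beta_d}^* s$. Then $t =_\beta s$. Moreover, a $\lambda$-term $s$ is a normal form for $\to_{\beta_d}$ if and only if it is a $\beta$-normal form.
   Context: $\lambda$-terms: $s,t ::= x \mid \lambda x.t \mid st$, modulo $\alpha$-conversion, with the distinct names convention; $t\{s/x\}$ is capture-avoiding substitution; $=_\beta$ is $\beta$-equivalence (the equivalence generated by $(\lambda x.t)s \to_\beta t\{s/x\}$ closed under contexts). Contexts are terms with one hole $\square$; $C[t]$ is plugging without renaming. E-contexts are generated by $E ::= \square \mid E_1[\lambda x.E_2]\,t$ ($E_1,E_2$ E-contexts, $t$ a term). A $\beta$-redex at a distance is a term of the form $E[\lambda x.t]s$ with $E$ an E-context. The $\beta$-reduction at a distance $\to_{\beta_d}$ is the closure under arbitrary contexts of the rule $E[\lambda x.t]s \to_{\beta_d} E[t\{s/x\}]$ ($E$ an E-context); $\to_{\beta_d}^*$ is its reflexive-transitive closure. -}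

module Defs where

open import Data.Nat using (ℕ; zero; suc; _+_; _<ᵇ_; _≡ᵇ_; pred)
open import Data.Bool using (if_then_else_)
open import Data.Product using (∃)
open import Relation.Nullary using (¬_)
open import Relation.Binary.Construct.Closure.ReflexiveTransitive using (Star)
open import Relation.Binary.Construct.Closure.Equivalence using (EqClosure)

-- λ-terms modulo α-conversion, represented with de Bruijn indices.
data Term : Set where
  var : ℕ → Term
  lam : Term → Term
  app : Term → Term → Term

shift : ℕ → Term → Term
shift c (var x) = if x <ᵇ c then var x else var (suc x)
shift c (lam t) = lam (shift (suc c) t)
shift c (app t u) = app (shift c t) (shift c u)

shiftN : ℕ → Term → Term
shiftN zero s = s
shiftN (suc k) s = shift 0 (shiftN k s)

-- capture-avoiding substitution of s for index j, removing the binder j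
subst : ℕ → Term → Term → Term
subst j s (var x) = if x ≡ᵇ j then s else (if x <ᵇ j then var x else var (pred x))
subst j s (lam t) = lam (subst (suc j) (shift 0 s) t)
subst j s (app t u) = app (subst j s t) (subst j s u)

-- t{s/x} where t is the body of λx.t
_[_] : Term → Term → Term
t [ s ] = subst 0 s t

-- E-contexts, indexed by the number of binders above the hole:
--   E ::= □ | E₁[λx.E₂] t
data ECtx : ℕ → Set where
  hole : ECtx 0
  ectx : ∀ {m n} → ECtx m → ECtx n → Term → ECtx (m + suc n)

-- plugging (without renaming)
plugE : ∀ {k} → ECtx k → Term → Term
plugE hole u = u
plugE (ectx E₁ E₂ t) u = app (plugE E₁ (lam (plugE E₂ u))) t

data _↦β_ : Term → Term → Set where
  beta : ∀ t s → app (lam t) s ↦β (t [ s ])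

-- β at a distance root step: E[λx.t]s ↦ E[t{s/x}]
-- (s is weakened past the k binders of E: distinct names convention)
data _↦βd_ : Term → Term → Set where
  betad : ∀ {k} (E : ECtx k) t s →
          app (plugE E (lam t)) s ↦βd plugE E (t [ shiftN k s ])

data Ctx (R : Term → Term → Set) : Term → Term → Set where
  root : ∀ {t u} → R t u → Ctx R t u
  ξlam : ∀ {t u} → Ctx R t u → Ctx R (lam t) (lam u)
  ξappL : ∀ {t u s} → Ctx R t u → Ctx R (app t s) (app u s)
  ξappR : ∀ {t u s} → Ctx R t u → Ctx R (app s t) (app s u)

_→β_ : Term → Term → Set
_→β_ = Ctx _↦β_

_→βd_ : Term → Term → Set
_→βd_ = Ctx _↦βd_

_→βd*_ : Term → Term → Set
_→βd*_ = Star _→βd_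

_=β_ : Term → Term → Set
_=β_ = EqClosure _→β_

NormalForm : (Term → Term → Set) → Term → Set
NormalForm R s = ¬ ∃ (λ u → R s u)

-- An E-context E with k binders above its hole is a stack of β-redexes; firing
-- them turns E[X] into X under a substitution ⟦E⟧ that sends the k hole-binders
-- to the arguments of E and the index k + y to y. Hence both sides of a distant
-- step E[λx.t]s ↦ E[t{s/x}] β-reduce to t under s • ⟦E⟧. For normal forms: a
-- root β-step is a distant step with E = □, and conversely E[λx.t]s always has
-- an ordinary β-redex at the head of its spine.
module Submission where

open import Defs
open import Data.Bool using (true; false; if_then_else_)
open import Data.Nat using (ℕ; zero; suc; _+_; _<ᵇ_; _≡ᵇ_; pred)
open import Data.Nat.Tactic.RingSolver using (solve-∀)
open import Data.Product using (_×_; _,_; ∃)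
open import Function.Base using (_∘_; id)
open import Function.Bundles using (_⇔_; mk⇔)
open import Relation.Binary.PropositionalEquality
  using (_≡_; refl; sym; trans; cong; cong₂; _≗_; module ≡-Reasoning)
  renaming (subst to ≡-subst)
open import Relation.Binary.Construct.Closure.ReflexiveTransitive as Star
  using (Star; ε; _◅_; _◅◅_)
open import Relation.Binary.Construct.Closure.Symmetric using (fwd)
open import Relation.Binary.Construct.Closure.Equivalence as EqClosure
  using (EqClosure)

Ren : Set
Ren = ℕ → ℕ

Sub : Set
Sub = ℕ → Term

ext : Ren → Ren
ext ρ zero = zero
ext ρ (suc x) = suc (ρ x)

rename : Ren → Term → Term
rename ρ (var x) = var (ρ x)
rename ρ (lam t) = lam (rename (ext ρ) t)
rename ρ (app t u) = app (rename ρ t) (rename ρ u)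

exts : Sub → Sub
exts σ zero = var zero
exts σ (suc x) = rename suc (σ x)

sub : Sub → Term → Term
sub σ (var x) = σ x
sub σ (lam t) = lam (sub (exts σ) t)
sub σ (app t u) = app (sub σ t) (sub σ u)

infixr 5 _•_

_•_ : Term → Sub → Sub
(s • σ) zero = s
(s • σ) (suc x) = σ x

ext-cong : ∀ {ρ ρ′} → ρ ≗ ρ′ → ext ρ ≗ ext ρ′
ext-cong h zero = refl
ext-cong h (suc x) = cong suc (h x)

rename-cong : ∀ {ρ ρ′} → ρ ≗ ρ′ → rename ρ ≗ rename ρ′
rename-cong h (var x) = cong var (h x)
rename-cong h (lam t) = cong lam (rename-cong (ext-cong h) t)
rename-cong h (app t u) = cong₂ app (rename-cong h t) (rename-cong h u)

exts-cong : ∀ {σ σ′} → σ ≗ σ′ → exts σ ≗ exts σ′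
exts-cong h zero = refl
exts-cong h (suc x) = cong (rename suc) (h x)

sub-cong : ∀ {σ σ′} → σ ≗ σ′ → sub σ ≗ sub σ′
sub-cong h (var x) = h x
sub-cong h (lam t) = cong lam (sub-cong (exts-cong h) t)
sub-cong h (app t u) = cong₂ app (sub-cong h t) (sub-cong h u)

rename-id : rename id ≗ id
rename-id (var x) = refl
rename-id (lam t) = cong lam (trans (rename-cong (λ { zero → refl ; (suc x) → refl }) t) (rename-id t))
rename-id (app t u) = cong₂ app (rename-id t) (rename-id u)

sub-var : sub var ≗ id
sub-var (var x) = refl
sub-var (lam t) = cong lam (trans (sub-cong (λ { zero → refl ; (suc x) → refl }) t) (sub-var t))
sub-var (app t u) = cong₂ app (sub-var t) (sub-var u)

rename-rename : ∀ ρ ρ′ → rename ρ ∘ rename ρ′ ≗ rename (ρ ∘ ρ′)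
rename-rename ρ ρ′ (var x) = refl
rename-rename ρ ρ′ (lam t) = cong lam (trans (rename-rename (ext ρ) (ext ρ′) t)
  (rename-cong (λ { zero → refl ; (suc x) → refl }) t))
rename-rename ρ ρ′ (app t u) = cong₂ app (rename-rename ρ ρ′ t) (rename-rename ρ ρ′ u)

sub-rename : ∀ σ ρ → sub σ ∘ rename ρ ≗ sub (σ ∘ ρ)
sub-rename σ ρ (var x) = refl
sub-rename σ ρ (lam t) = cong lam (trans (sub-rename (exts σ) (ext ρ) t)
  (sub-cong (λ { zero → refl ; (suc x) → refl }) t))
sub-rename σ ρ (app t u) = cong₂ app (sub-rename σ ρ t) (sub-rename σ ρ u)

rename-sub : ∀ ρ σ → rename ρ ∘ sub σ ≗ sub (rename ρ ∘ σ)
rename-sub ρ σ (var x) = refl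
rename-sub ρ σ (lam t) = cong lam (trans (rename-sub (ext ρ) (exts σ) t) (sub-cong exts-comm t))
  where
  exts-comm : rename (ext ρ) ∘ exts σ ≗ exts (rename ρ ∘ σ)
  exts-comm zero = refl
  exts-comm (suc x) = trans (rename-rename (ext ρ) suc (σ x)) (sym (rename-rename suc ρ (σ x)))
rename-sub ρ σ (app t u) = cong₂ app (rename-sub ρ σ t) (rename-sub ρ σ u)

sub-sub : ∀ τ σ → sub τ ∘ sub σ ≗ sub (sub τ ∘ σ)
sub-sub τ σ (var x) = refl
sub-sub τ σ (lam t) = cong lam (trans (sub-sub (exts τ) (exts σ) t) (sub-cong exts-comp t))
  where
  exts-comp : sub (exts τ) ∘ exts σ ≗ exts (sub τ ∘ σ)
  exts-comp zero = refl
  exts-comp (suc x) = trans (sub-rename (exts τ) suc (σ x)) (sym (rename-sub suc τ (σ x)))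
sub-sub τ σ (app t u) = cong₂ app (sub-sub τ σ t) (sub-sub τ σ u)

shiftRen : ℕ → Ren
shiftRen zero = suc
shiftRen (suc c) = ext (shiftRen c)

shift-var : ∀ c x → (if x <ᵇ c then var x else var (suc x)) ≡ var (shiftRen c x)
shift-var zero x = refl
shift-var (suc c) zero = refl
shift-var (suc c) (suc x) with x <ᵇ c | shift-var c x
... | true  | eq = cong (rename suc) eq
... | false | eq = cong (rename suc) eq

shift-rename : ∀ c → shift c ≗ rename (shiftRen c)
shift-rename c (var x) = shift-var c x
shift-rename c (lam t) = cong lam (shift-rename (suc c) t)
shift-rename c (app t u) = cong₂ app (shift-rename c t) (shift-rename c u)

shiftN-rename : ∀ k → shiftN k ≗ rename (k +_)
shiftN-rename zero s = sym (rename-id s)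
shiftN-rename (suc k) s = begin
  shift 0 (shiftN k s)          ≡⟨ shift-rename 0 (shiftN k s) ⟩
  rename suc (shiftN k s)       ≡⟨ cong (rename suc) (shiftN-rename k s) ⟩
  rename suc (rename (k +_) s)  ≡⟨ rename-rename suc (k +_) s ⟩
  rename (suc k +_) s           ∎
  where open ≡-Reasoning

substSub : ℕ → Term → Sub
substSub j s x = if x ≡ᵇ j then s else (if x <ᵇ j then var x else var (pred x))

exts-substSub : ∀ j s → exts (substSub j s) ≗ substSub (suc j) (shift 0 s)
exts-substSub j s zero = refl
exts-substSub zero s (suc zero) = sym (shift-rename 0 s)
exts-substSub (suc j) s (suc zero) = refl
exts-substSub j s (suc (suc y)) with suc y ≡ᵇ j | suc y <ᵇ j
... | true  | _     = sym (shift-rename 0 s)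
... | false | true  = refl
... | false | false = refl

subst-sub : ∀ j s → subst j s ≗ sub (substSub j s)
subst-sub j s (var x) = refl
subst-sub j s (lam t) = cong lam (trans (subst-sub (suc j) (shift 0 s) t)
  (sym (sub-cong (exts-substSub j s) t)))
subst-sub j s (app t u) = cong₂ app (subst-sub j s t) (subst-sub j s u)

[]-sub : ∀ t s → t [ s ] ≡ sub (s • var) t
[]-sub t s = trans (subst-sub 0 s t) (sub-cong (λ { zero → refl ; (suc x) → refl }) t)

sub-exts-[] : ∀ σ t s → sub (exts σ) t [ s ] ≡ sub (s • σ) t
sub-exts-[] σ t s = begin
  sub (exts σ) t [ s ]              ≡⟨ []-sub (sub (exts σ) t) s ⟩
  sub (s • var) (sub (exts σ) t)    ≡⟨ sub-sub (s • var) (exts σ) t ⟩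
  sub (sub (s • var) ∘ exts σ) t    ≡⟨ sub-cong cancel t ⟩
  sub (s • σ) t                     ∎
  where
  open ≡-Reasoning
  cancel : sub (s • var) ∘ exts σ ≗ s • σ
  cancel zero = refl
  cancel (suc x) = trans (sub-rename (s • var) suc (σ x)) (sub-var (σ x))

sub-[] : ∀ σ t s → sub σ (t [ s ]) ≡ sub (exts σ) t [ sub σ s ]
sub-[] σ t s = begin
  sub σ (t [ s ])               ≡⟨ cong (sub σ) ([]-sub t s) ⟩
  sub σ (sub (s • var) t)       ≡⟨ sub-sub σ (s • var) t ⟩
  sub (sub σ ∘ (s • var)) t     ≡⟨ sub-cong (λ { zero → refl ; (suc x) → refl }) t ⟩
  sub (sub σ s • σ) t           ≡⟨ sym (sub-exts-[] σ t (sub σ s)) ⟩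
  sub (exts σ) t [ sub σ s ]    ∎
  where open ≡-Reasoning

Ctx-map : ∀ {R S} → (∀ {t u} → R t u → S t u) → ∀ {t u} → Ctx R t u → Ctx S t u
Ctx-map f (root r) = root (f r)
Ctx-map f (ξlam r) = ξlam (Ctx-map f r)
Ctx-map f (ξappL r) = ξappL (Ctx-map f r)
Ctx-map f (ξappR r) = ξappR (Ctx-map f r)

Ctx-reducible : ∀ {R S} → (∀ {t u} → R t u → ∃ (Ctx S t)) → ∀ {t u} → Ctx R t u → ∃ (Ctx S t)
Ctx-reducible f (root r) = f r
Ctx-reducible f (ξlam r) with Ctx-reducible f r
... | _ , r′ = _ , ξlam r′
Ctx-reducible f (ξappL r) with Ctx-reducible f r
... | _ , r′ = _ , ξappL r′
Ctx-reducible f (ξappR r) with Ctx-reducible f r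
... | _ , r′ = _ , ξappR r′

Ctx-EqClosure : ∀ {R S} → (∀ {t u} → R t u → EqClosure (Ctx S) t u) →
                ∀ {t u} → Ctx R t u → EqClosure (Ctx S) t u
Ctx-EqClosure f (root r) = f r
Ctx-EqClosure f (ξlam r) = EqClosure.gmap lam ξlam (Ctx-EqClosure f r)
Ctx-EqClosure f (ξappL r) = EqClosure.gmap _ ξappL (Ctx-EqClosure f r)
Ctx-EqClosure f (ξappR r) = EqClosure.gmap _ ξappR (Ctx-EqClosure f r)

_→β*_ : Term → Term → Set
_→β*_ = Star _→β_

≡⇒→β* : ∀ {t u} → t ≡ u → t →β* u
≡⇒→β* refl = ε

common-reduct⇒=β : ∀ {t u v} → t →β* v → u →β* v → t =β u
common-reduct⇒=β tv uv =
  EqClosure.transitive _→β_ (Star.map fwd tv) (EqClosure.symmetric _→β_ (Star.map fwd uv))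

sub-→β : ∀ σ {t u} → t →β u → sub σ t →β sub σ u
sub-→β σ (root (beta t s)) =
  ≡-subst (sub σ (app (lam t) s) →β_) (sym (sub-[] σ t s)) (root (beta _ _))
sub-→β σ (ξlam r) = ξlam (sub-→β (exts σ) r)
sub-→β σ (ξappL r) = ξappL (sub-→β σ r)
sub-→β σ (ξappR r) = ξappR (sub-→β σ r)

sub-→β* : ∀ σ {t u} → t →β* u → sub σ t →β* sub σ u
sub-→β* σ = Star.gmap (sub σ) (sub-→β σ)

appL-→β* : ∀ s {t u} → t →β* u → app t s →β* app u s
appL-→β* s = Star.gmap (λ t → app t s) ξappL

⟦_⟧ : ∀ {k} → ECtx k → Sub
⟦ hole ⟧ = var
⟦ ectx E₁ E₂ u ⟧ = sub (u • ⟦ E₁ ⟧) ∘ ⟦ E₂ ⟧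

plugE-→β* : ∀ {k} (E : ECtx k) X → plugE E X →β* sub ⟦ E ⟧ X
plugE-→β* hole X = ≡⇒→β* (sym (sub-var X))
plugE-→β* (ectx E₁ E₂ u) X =
  appL-→β* u (plugE-→β* E₁ (lam (plugE E₂ X)))
  ◅◅ root (beta _ _) ◅ ≡⇒→β* (sub-exts-[] ⟦ E₁ ⟧ (plugE E₂ X) u)
  ◅◅ sub-→β* (u • ⟦ E₁ ⟧) (plugE-→β* E₂ X)
  ◅◅ ≡⇒→β* (sub-sub (u • ⟦ E₁ ⟧) ⟦ E₂ ⟧ X)

⟦⟧-beyond : ∀ {k} (E : ECtx k) y → ⟦ E ⟧ (k + y) ≡ var y
⟦⟧-beyond hole y = refl
⟦⟧-beyond (ectx {m} {n} E₁ E₂ u) y = begin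
  sub (u • ⟦ E₁ ⟧) (⟦ E₂ ⟧ (m + suc n + y))       ≡⟨ cong (sub (u • ⟦ E₁ ⟧) ∘ ⟦ E₂ ⟧) (reassoc m n y) ⟩
  sub (u • ⟦ E₁ ⟧) (⟦ E₂ ⟧ (n + suc (m + y)))     ≡⟨ cong (sub (u • ⟦ E₁ ⟧)) (⟦⟧-beyond E₂ (suc (m + y))) ⟩
  ⟦ E₁ ⟧ (m + y)                                  ≡⟨ ⟦⟧-beyond E₁ y ⟩
  var y                                           ∎
  where
  open ≡-Reasoning
  reassoc : ∀ m n y → m + suc n + y ≡ n + suc (m + y)
  reassoc = solve-∀

sub-⟦⟧-shiftN : ∀ {k} (E : ECtx k) s → sub ⟦ E ⟧ (shiftN k s) ≡ s
sub-⟦⟧-shiftN {k} E s = begin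
  sub ⟦ E ⟧ (shiftN k s)           ≡⟨ cong (sub ⟦ E ⟧) (shiftN-rename k s) ⟩
  sub ⟦ E ⟧ (rename (k +_) s)      ≡⟨ sub-rename ⟦ E ⟧ (k +_) s ⟩
  sub (⟦ E ⟧ ∘ (k +_)) s           ≡⟨ sub-cong (⟦⟧-beyond E) s ⟩
  sub var s                        ≡⟨ sub-var s ⟩
  s                                ∎
  where open ≡-Reasoning

↦βd⇒=β : ∀ {t u} → t ↦βd u → t =β u
↦βd⇒=β (betad {k} E t s) = common-reduct⇒=β redex⇒ contractum⇒
  where
  redex⇒ : app (plugE E (lam t)) s →β* sub (s • ⟦ E ⟧) t
  redex⇒ = appL-→β* s (plugE-→β* E (lam t))
           ◅◅ root (beta _ _) ◅ ≡⇒→β* (sub-exts-[] ⟦ E ⟧ t s)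
  weakened-arg : sub ⟦ E ⟧ ∘ (shiftN k s • var) ≗ s • ⟦ E ⟧
  weakened-arg zero = sub-⟦⟧-shiftN E s
  weakened-arg (suc y) = refl
  contractum⇒ : plugE E (t [ shiftN k s ]) →β* sub (s • ⟦ E ⟧) t
  contractum⇒ = plugE-→β* E _ ◅◅ ≡⇒→β* (begin
    sub ⟦ E ⟧ (t [ shiftN k s ])                ≡⟨ cong (sub ⟦ E ⟧) ([]-sub t (shiftN k s)) ⟩
    sub ⟦ E ⟧ (sub (shiftN k s • var) t)        ≡⟨ sub-sub ⟦ E ⟧ _ t ⟩
    sub (sub ⟦ E ⟧ ∘ (shiftN k s • var)) t      ≡⟨ sub-cong weakened-arg t ⟩
    sub (s • ⟦ E ⟧) t                           ∎)
    where open ≡-Reasoning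

→βd*⇒=β : ∀ t s → t →βd* s → t =β s
→βd*⇒=β _ _ = Star.concat ∘ Star.map (Ctx-EqClosure ↦βd⇒=β)

↦β⇒↦βd : ∀ {t u} → t ↦β u → t ↦βd u
↦β⇒↦βd (beta t s) = betad hole t s

plugE-redex-reducible : ∀ {k} (E : ECtx k) t s → ∃ (app (plugE E (lam t)) s →β_)
plugE-redex-reducible hole t s = _ , root (beta t s)
plugE-redex-reducible (ectx E₁ E₂ u) t s with plugE-redex-reducible E₁ (plugE E₂ (lam t)) u
... | _ , r = _ , ξappL r

↦βd⇒β-reducible : ∀ {t u} → t ↦βd u → ∃ (t →β_)
↦βd⇒β-reducible (betad E t s) = plugE-redex-reducible E t s

proposition6 : (∀ (t s : Term) → t →βd* s → t =β s)
    × (∀ (s : Term) → NormalForm _→βd_ s ⇔ NormalForm _→β_ s)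
proposition6 = →βd*⇒=β , λ s → mk⇔
  (λ βd-nf (u , r) → βd-nf (u , Ctx-map ↦β⇒↦βd r))
  (λ β-nf (u , r) → β-nf (Ctx-reducible ↦βd⇒β-reducible r))
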